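{- Let $\varphi$ be a sentence and let $\Delta$ be a set of formulas that is $\varphi$-saturated in ${\sf HQBD2}$ (i.e. $\Delta\nvdash_{\sf HQBD2}\varphi$, but $\Delta,\alpha\vdash_{\sf HQBD2}\varphi$ for every formula $\alpha\notin\Delta$). Then either $\neg\varphi\wedge\copyright\varphi\in\Delta$ or $\neg\copyright\varphi\wedge\copyright\varphi\in\Delta$.
   Context: Fix a first-order signature (predicate, function, constant symbols); formulas use $\wedge,\vee,\to,\neg,\copyright,\forall$; $\varphi[x/t]$ is substitution for free occurrences; $\alpha\leftrightarrow\beta$ abbreviates $(\alpha\to\beta)\wedge(\beta\to\alpha)$. The calculus ${\sf HQBD2}$ has as axioms all first-order instances of: (P1) $\alpha\to(\beta\to\alpha)$; (P2) $(\alpha\to(\beta\to\gamma))\to((\alpha\to\beta)\to(\alpha\to\gamma))$; (P3) $\alpha\wedge\beta\to\alpha$; (P4) $\alpha\wedge\beta\to\beta$; (P5) $\alpha\to(\beta\to(\alpha\wedge\beta))$; (P6) $\alpha\to(\alpha\vee\beta)$; (P7) $\alpha\to(\beta\vee\alpha)$; (P8) $(\alpha\to\gamma)\to((\beta\to\gamma)\to(\alpha\vee\beta\to\gamma))$; (P9) $\alpha\vee(\alpha\to\beta)$; $\neg\neg\alpha\leftrightarrow\alpha$; $\neg(\alpha\vee\beta)\leftrightarrow(\neg\alpha\wedge\neg\beta)$; $\neg(\alpha\wedge\beta)\leftrightarrow(\neg\alpha\vee\neg\beta)$; $\neg(\alpha\to\beta)\leftrightarrow((\neg\alpha\to\alpha)\wedge\neg\beta)$;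 $(\copyright\alpha\wedge(\alpha\wedge\neg\alpha))\to\beta$; $\copyright\alpha\vee(\alpha\wedge\neg\alpha)$; $\neg\copyright\alpha\leftrightarrow(\alpha\leftrightarrow\neg\alpha)$; plus (A) $\forall x\varphi\to\varphi[x/t]$, (B) $\neg\forall x\varphi\to\neg\forall x\neg\neg\varphi$, (C) $\neg\varphi[x/t]\to\neg\forall x\varphi$, for $t$ free for $x$ in $\varphi$. Rules: modus ponens; from $\alpha\to\beta$ infer $\alpha\to\forall x\beta$ ($x$ not free in $\alpha$); from $\beta\to\alpha$ infer $\neg\forall x\neg\beta\to\alpha$ ($x$ not free in $\alpha$). $\Gamma\vdash\varphi$ means there is a finite sequence ending in $\varphi$ each of whose members is an axiom, a member of $\Gamma$, or obtained from earlier members by a rule. -}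

module Defs where

open import Data.Nat using (ℕ; _≡ᵇ_)
open import Data.Bool using (Bool; true; false; _∨_; _∧_; not; if_then_else_)
open import Data.Vec using (Vec; []; _∷_)
open import Data.Sum using (_⊎_)
open import Relation.Binary.PropositionalEquality using (_≡_)
open import Relation.Nullary using (¬_)

-- A first-order signature: predicate symbols and function symbols with
-- arities; constant symbols are the function symbols of arity 0.
record Signature : Set₁ where
  field
    Pred   : Set
    parity : Pred → ℕ
    Fun    : Set
    farity : Fun → ℕ

module Syntax (S : Signature) where
  open Signature S

  data Term : Set where
    var : ℕ → Term
    app : (f : Fun) → Vec Term (farity f) → Term

  infix  5 _⇔_
  infixr 6 _⇒_
  infixl 7 _⋁_
  infixl 8 _⋀_
  infix  9 ∼_ ©_

  data Formula : Set where
    atom : (p : Pred) → Vec Term (parity p) → Formula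
    _⋀_ _⋁_ _⇒_ : Formula → Formula → Formula
    ∼_ ©_ : Formula → Formula
    ∀' : ℕ → Formula → Formula

  _⇔_ : Formula → Formula → Formula
  α ⇔ β = (α ⇒ β) ⋀ (β ⇒ α)

  mutual
    occT : ℕ → Term → Bool
    occT x (var y) = x ≡ᵇ y
    occT x (app f ts) = occTs x ts

    occTs : ∀ {n} → ℕ → Vec Term n → Bool
    occTs x [] = false
    occTs x (t ∷ ts) = occT x t ∨ occTs x ts

  free : ℕ → Formula → Bool
  free x (atom p ts) = occTs x ts
  free x (α ⋀ β) = free x α ∨ free x β
  free x (α ⋁ β) = free x α ∨ free x β
  free x (α ⇒ β) = free x α ∨ free x β
  free x (∼ α) = free x α
  free x (© α) = free x α
  free x (∀' y α) = not (x ≡ᵇ y) ∧ free x α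

  NotFree : ℕ → Formula → Set
  NotFree x α = free x α ≡ false

  Sentence : Formula → Set
  Sentence φ = ∀ x → NotFree x φ

  mutual
    substT : Term → ℕ → Term → Term
    substT (var y) x t = if x ≡ᵇ y then t else var y
    substT (app f ts) x t = app f (substTs ts x t)

    substTs : ∀ {n} → Vec Term n → ℕ → Term → Vec Term n
    substTs [] x t = []
    substTs (u ∷ us) x t = substT u x t ∷ substTs us x t

  _[_/_] : Formula → ℕ → Term → Formula
  atom p ts [ x / t ] = atom p (substTs ts x t)
  (α ⋀ β) [ x / t ] = (α [ x / t ]) ⋀ (β [ x / t ])
  (α ⋁ β) [ x / t ] = (α [ x / t ]) ⋁ (β [ x / t ])
  (α ⇒ β) [ x / t ] = (α [ x / t ]) ⇒ (β [ x / t ])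
  (∼ α) [ x / t ] = ∼ (α [ x / t ])
  (© α) [ x / t ] = © (α [ x / t ])
  ∀' y α [ x / t ] = if x ≡ᵇ y then ∀' y α else ∀' y (α [ x / t ])

  freeForB : Term → ℕ → Formula → Bool
  freeForB t x (atom p ts) = true
  freeForB t x (α ⋀ β) = freeForB t x α ∧ freeForB t x β
  freeForB t x (α ⋁ β) = freeForB t x α ∧ freeForB t x β
  freeForB t x (α ⇒ β) = freeForB t x α ∧ freeForB t x β
  freeForB t x (∼ α) = freeForB t x α
  freeForB t x (© α) = freeForB t x α
  freeForB t x (∀' y α) =
    not (free x (∀' y α)) ∨ (not (occT y t) ∧ freeForB t x α)

  FreeFor : Term → ℕ → Formula → Set
  FreeFor t x φ = freeForB t x φ ≡ true

  data Axiom : Formula → Set where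
    P1 : ∀ α β → Axiom (α ⇒ (β ⇒ α))
    P2 : ∀ α β γ → Axiom ((α ⇒ (β ⇒ γ)) ⇒ ((α ⇒ β) ⇒ (α ⇒ γ)))
    P3 : ∀ α β → Axiom (α ⋀ β ⇒ α)
    P4 : ∀ α β → Axiom (α ⋀ β ⇒ β)
    P5 : ∀ α β → Axiom (α ⇒ (β ⇒ (α ⋀ β)))
    P6 : ∀ α β → Axiom (α ⇒ (α ⋁ β))
    P7 : ∀ α β → Axiom (α ⇒ (β ⋁ α))
    P8 : ∀ α β γ → Axiom ((α ⇒ γ) ⇒ ((β ⇒ γ) ⇒ (α ⋁ β ⇒ γ)))
    P9 : ∀ α β → Axiom (α ⋁ (α ⇒ β))
    dneg : ∀ α → Axiom (∼ ∼ α ⇔ α)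
    negOr : ∀ α β → Axiom (∼ (α ⋁ β) ⇔ (∼ α ⋀ ∼ β))
    negAnd : ∀ α β → Axiom (∼ (α ⋀ β) ⇔ (∼ α ⋁ ∼ β))
    negImp : ∀ α β → Axiom (∼ (α ⇒ β) ⇔ ((∼ α ⇒ α) ⋀ ∼ β))
    exp© : ∀ α β → Axiom ((© α ⋀ (α ⋀ ∼ α)) ⇒ β)
    lem© : ∀ α → Axiom (© α ⋁ (α ⋀ ∼ α))
    neg© : ∀ α → Axiom (∼ © α ⇔ (α ⇔ ∼ α))
    axA : ∀ x φ t → FreeFor t x φ → Axiom (∀' x φ ⇒ (φ [ x / t ]))
    axB : ∀ x φ → Axiom (∼ ∀' x φ ⇒ ∼ ∀' x (∼ ∼ φ))
    axC : ∀ x φ t → FreeFor t x φ → Axiom (∼ (φ [ x / t ]) ⇒ ∼ ∀' x φ)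

  FSet : Set₁
  FSet = Formula → Set

  -- derivability in HQBD2 from a set of premises
  -- (derivation trees = finite derivation sequences)
  infix 4 _⊢_
  data _⊢_ (Γ : FSet) : Formula → Set where
    ax  : ∀ {φ} → Axiom φ → Γ ⊢ φ
    hyp : ∀ {φ} → Γ φ → Γ ⊢ φ
    mp  : ∀ {α β} → Γ ⊢ α → Γ ⊢ α ⇒ β → Γ ⊢ β
    gen : ∀ {α β x} → Γ ⊢ α ⇒ β → NotFree x α → Γ ⊢ α ⇒ ∀' x β
    exi : ∀ {α β x} → Γ ⊢ β ⇒ α → NotFree x α → Γ ⊢ ∼ ∀' x (∼ β) ⇒ α

  _,,_ : FSet → Formula → FSet
  (Γ ,, α) ψ = Γ ψ ⊎ ψ ≡ α

  _∉_ : Formula → FSet → Set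
  α ∉ Γ = ¬ Γ α

  record Saturated (Δ : FSet) (φ : Formula) : Set where
    field
      underivable : ¬ (Δ ⊢ φ)
      maximal     : ∀ α → α ∉ Δ → (Δ ,, α) ⊢ φ

-- Under excluded middle a φ-saturated set Δ is deductively closed, and it is
-- prime for sentences: if Δ ⊢ α ⋁ β then α ∈ Δ or β ∈ Δ, since otherwise both
-- α ⇒ φ and β ⇒ φ are derivable (deduction theorem) and so is φ.  Primeness
-- applied to ©φ ⋁ (φ ⋀ ∼φ) and to φ ⋁ (φ ⇒ ∼φ) puts ©φ and φ ⇒ ∼φ in Δ, as
-- φ ∉ Δ.  If ∼φ ∈ Δ we get ∼φ ⋀ ©φ; otherwise ∼φ ⇒ φ is derivable, hence
-- φ ⇔ ∼φ and, by the axiom for ∼©, also ∼©φ, giving ∼©φ ⋀ ©φ.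
module Submission where

open import Defs
open import Data.Sum using (_⊎_; inj₁; inj₂)
open import Data.Empty using (⊥-elim)
open import Axiom.ExcludedMiddle using (ExcludedMiddle)
open import Level using (0ℓ)
open import Relation.Nullary using (yes; no)
open import Data.Bool using (false; _∨_)
open import Relation.Binary.PropositionalEquality using (_≡_; refl)

∨-false : ∀ {a b} → a ≡ false → b ≡ false → a ∨ b ≡ false
∨-false refl refl = refl

module HQBD2 (S : Signature) where
  open Syntax S

  sentence-⋀ : ∀ {α β} → Sentence α → Sentence β → Sentence (α ⋀ β)
  sentence-⋀ sα sβ x = ∨-false (sα x) (sβ x)

  sentence-⇒ : ∀ {α β} → Sentence α → Sentence β → Sentence (α ⇒ β)
  sentence-⇒ sα sβ x = ∨-false (sα x) (sβ x)

  module _ {Γ : FSet} where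

    ⇒-refl : ∀ {α} → Γ ⊢ α ⇒ α
    ⇒-refl {α} = mp (ax (P1 α α)) (mp (ax (P1 α (α ⇒ α))) (ax (P2 α (α ⇒ α) α)))

    ⇒-const : ∀ {α β} → Γ ⊢ β → Γ ⊢ α ⇒ β
    ⇒-const {α} {β} d = mp d (ax (P1 β α))

    ⇒-mp : ∀ {γ α β} → Γ ⊢ γ ⇒ α → Γ ⊢ γ ⇒ (α ⇒ β) → Γ ⊢ γ ⇒ β
    ⇒-mp {γ} {α} {β} d e = mp d (mp e (ax (P2 γ α β)))

    ⇒-trans : ∀ {α β γ} → Γ ⊢ α ⇒ β → Γ ⊢ β ⇒ γ → Γ ⊢ α ⇒ γ
    ⇒-trans d e = ⇒-mp d (⇒-const e)

    ⇒-⋀-intro : ∀ {γ α β} → Γ ⊢ γ ⇒ α → Γ ⊢ γ ⇒ β → Γ ⊢ γ ⇒ α ⋀ β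
    ⇒-⋀-intro {α = α} {β} d e = ⇒-mp e (⇒-mp d (⇒-const (ax (P5 α β))))

    ⇒-uncurry : ∀ {γ α β} → Γ ⊢ γ ⇒ (α ⇒ β) → Γ ⊢ γ ⋀ α ⇒ β
    ⇒-uncurry {γ} {α} d = ⇒-mp (ax (P4 γ α)) (⇒-mp (ax (P3 γ α)) (⇒-const d))

    ⇒-curry : ∀ {γ α β} → Γ ⊢ γ ⋀ α ⇒ β → Γ ⊢ γ ⇒ (α ⇒ β)
    ⇒-curry {γ} {α} {β} d = ⇒-trans (ax (P5 γ α)) (mp (⇒-const d) (ax (P2 α (γ ⋀ α) β)))

    ⇒-swap : ∀ {α β γ} → Γ ⊢ α ⇒ (β ⇒ γ) → Γ ⊢ β ⇒ (α ⇒ γ)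
    ⇒-swap {α} {β} d = ⇒-curry (⇒-trans (⇒-⋀-intro (ax (P4 β α)) (ax (P3 β α))) (⇒-uncurry d))

    ⋀-intro : ∀ {α β} → Γ ⊢ α → Γ ⊢ β → Γ ⊢ α ⋀ β
    ⋀-intro {α} {β} d e = mp e (mp d (ax (P5 α β)))

    ⋀-proj₁ : ∀ {α β} → Γ ⊢ α ⋀ β → Γ ⊢ α
    ⋀-proj₁ {α} {β} d = mp d (ax (P3 α β))

    ⋀-proj₂ : ∀ {α β} → Γ ⊢ α ⋀ β → Γ ⊢ β
    ⋀-proj₂ {α} {β} d = mp d (ax (P4 α β))

    ⋁-elim : ∀ {α β γ} → Γ ⊢ α ⇒ γ → Γ ⊢ β ⇒ γ → Γ ⊢ α ⋁ β → Γ ⊢ γ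
    ⋁-elim {α} {β} {γ} d e f = mp f (mp e (mp d (ax (P8 α β γ))))

  cut : ∀ {Γ ψ χ} → Γ ⊢ ψ → (Γ ,, ψ) ⊢ χ → Γ ⊢ χ
  cut d (ax a)            = ax a
  cut d (hyp (inj₁ h))    = hyp h
  cut d (hyp (inj₂ refl)) = d
  cut d (mp e f)          = mp (cut d e) (cut d f)
  cut d (gen e nf)        = gen (cut d e) nf
  cut d (exi e nf)        = exi (cut d e) nf

  -- A closed hypothesis never violates the side conditions of the two
  -- quantifier rules, which is why it can be discharged.
  deduction : ∀ {Γ γ ψ} → Sentence γ → (Γ ,, γ) ⊢ ψ → Γ ⊢ γ ⇒ ψ
  deduction s (ax a)                = ⇒-const (ax a)
  deduction s (hyp (inj₁ h))        = ⇒-const (hyp h)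
  deduction s (hyp (inj₂ refl))     = ⇒-refl
  deduction s (mp e f)              = ⇒-mp (deduction s e) (deduction s f)
  deduction s (gen {x = x} e nf)    = ⇒-curry (gen (⇒-uncurry (deduction s e)) (∨-false (s x) nf))
  deduction s (exi {x = x} e nf)    = ⇒-swap (exi (⇒-swap (deduction s e)) (∨-false (s x) nf))

  module SaturatedProperties (em : ExcludedMiddle 0ℓ) {Δ : FSet} {φ : Formula}
                             (sat : Saturated Δ φ) where
    open Saturated sat

    φ∉Δ : φ ∉ Δ
    φ∉Δ h = underivable (hyp h)

    ∉⇒⊢⇒φ : ∀ {γ} → Sentence γ → γ ∉ Δ → Δ ⊢ γ ⇒ φ
    ∉⇒⊢⇒φ {γ} s γ∉Δ = deduction s (maximal γ γ∉Δ)

    closed : ∀ {ψ} → Δ ⊢ ψ → Δ ψ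
    closed {ψ} d with em {Δ ψ}
    ... | yes ψ∈Δ = ψ∈Δ
    ... | no ψ∉Δ  = ⊥-elim (underivable (cut d (maximal ψ ψ∉Δ)))

    prime : ∀ {α β} → Sentence α → Sentence β → Δ ⊢ α ⋁ β → Δ α ⊎ Δ β
    prime {α} {β} sα sβ d with em {Δ α} | em {Δ β}
    ... | yes α∈Δ | _       = inj₁ α∈Δ
    ... | no _    | yes β∈Δ = inj₂ β∈Δ
    ... | no α∉Δ  | no β∉Δ  = ⊥-elim (underivable (⋁-elim (∉⇒⊢⇒φ sα α∉Δ) (∉⇒⊢⇒φ sβ β∉Δ) d))

    ©φ∈Δ : Sentence φ → Δ (© φ)
    ©φ∈Δ sφ with prime sφ (sentence-⋀ {φ} {∼ φ} sφ sφ) (ax (lem© φ))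
    ... | inj₁ ©φ∈Δ   = ©φ∈Δ
    ... | inj₂ φ∧∼φ∈Δ = ⊥-elim (underivable (⋀-proj₁ (hyp φ∧∼φ∈Δ)))

    φ⇒∼φ∈Δ : Sentence φ → Δ (φ ⇒ ∼ φ)
    φ⇒∼φ∈Δ sφ with prime sφ (sentence-⇒ {φ} {∼ φ} sφ sφ) (ax (P9 φ (∼ φ)))
    ... | inj₁ φ∈Δ    = ⊥-elim (φ∉Δ φ∈Δ)
    ... | inj₂ φ⇒∼φ∈Δ = φ⇒∼φ∈Δ

mainTheorem13 : ExcludedMiddle 0ℓ → (S : Signature) →
    let open Syntax S in
    (φ : Formula) → Sentence φ → (Δ : FSet) → Saturated Δ φ →
    Δ (∼ φ ⋀ © φ) ⊎ Δ (∼ © φ ⋀ © φ)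
mainTheorem13 em S φ sφ Δ sat = classify
  where
  open Syntax S
  open HQBD2 S
  open SaturatedProperties em sat

  classify : Δ (∼ φ ⋀ © φ) ⊎ Δ (∼ © φ ⋀ © φ)
  classify with em {Δ (∼ φ)}
  ... | yes ∼φ∈Δ = inj₁ (closed (⋀-intro (hyp ∼φ∈Δ) (hyp (©φ∈Δ sφ))))
  ... | no ∼φ∉Δ  = inj₂ (closed (⋀-intro ⊢∼©φ (hyp (©φ∈Δ sφ))))
    where
    ⊢φ⇔∼φ : Δ ⊢ φ ⇔ ∼ φ
    ⊢φ⇔∼φ = ⋀-intro (hyp (φ⇒∼φ∈Δ sφ)) (∉⇒⊢⇒φ sφ ∼φ∉Δ)

    ⊢∼©φ : Δ ⊢ ∼ © φ
    ⊢∼©φ = mp ⊢φ⇔∼φ (⋀-proj₂ (ax (neg© φ)))
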